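{- Let $F$ be a binary matroid and let $M$ be a binary matroid that has a minor belonging to the class $\widetilde{F}$. Then there exist elements $x,y\in E(M)$ such that the splitting matroid $M_{x,y}$ has a minor isomorphic to $F$.
   Context: Splitting operation: let $M$ be a binary matroid with a matrix representation $A$ over $GF(2)$ (columns labelled by $E(M)$), and let $\{x,y\}\subseteq E(M)$. Let $A_{x,y}$ be the matrix obtained from $A$ by adjoining one extra row whose entries are $1$ in the columns labelled $x$ and $y$ and $0$ elsewhere. The vector matroid of $A_{x,y}$ is denoted $M_{x,y}$ and called the splitting matroid of $M$ with respect to $x$ and $y$. Notation: for a binary matroid $F$, $\widetilde{F}$ denotes the collection of binary matroids $N$ containing a pair of elements $x,y$ satisfying one of: (1) $N\backslash\{x,y\}= F$; (2) $\{x,y\}$ is a 2-element cocircuit of $N$ and $N/x= F$; (3) $\{x,y\}$ is a 2-element cocircuit of $N$ and $N/\{x,y\}= F$ (equalities up to isomorphism). -}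

module Defs where

open import Data.Bool using (Bool; true; false; _∧_; _∨_; _xor_; not)
open import Data.Nat using (ℕ; zero; suc)
open import Data.Fin using (Fin; zero; suc; _≟_)
open import Data.Product using (Σ; _×_; _,_; ∃)
open import Data.Sum using (_⊎_)
open import Relation.Nullary using (¬_)
open import Relation.Nullary.Decidable using (⌊_⌋)
open import Relation.Binary.PropositionalEquality using (_≡_; _≢_)
open import Function.Definitions using (Injective)

FSet : ℕ → Set
FSet n = Fin n → Bool

xorSum : ∀ {n} → (Fin n → Bool) → Bool
xorSum {zero}  f = false
xorSum {suc n} f = f zero xor xorSum (λ i → f (suc i))

anyFin : ∀ {n} → (Fin n → Bool) → Bool
anyFin {zero}  f = false
anyFin {suc n} f = f zero ∨ anyFin (λ i → f (suc i))

_⊆_ : ∀ {n} → FSet n → FSet n → Set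
X ⊆ Y = ∀ e → X e ≡ true → Y e ≡ true

_∪_ : ∀ {n} → FSet n → FSet n → FSet n
(X ∪ Y) e = X e ∨ Y e

∅ : ∀ {n} → FSet n
∅ e = false

full : ∀ {n} → FSet n
full e = true

⁅_⁆ : ∀ {n} → Fin n → FSet n
⁅ x ⁆ e = ⌊ e ≟ x ⌋

pair : ∀ {n} → Fin n → Fin n → FSet n
pair x y e = ⌊ e ≟ x ⌋ ∨ ⌊ e ≟ y ⌋

IsEmpty : ∀ {n} → FSet n → Set
IsEmpty X = ∀ e → X e ≡ false

Disjoint : ∀ {n} → FSet n → FSet n → Set
Disjoint X Y = ∀ e → X e ≡ true → Y e ≡ false

-- A binary matroid, given by a representing matrix over GF(2) = Bool
-- (rows × cols, columns = ground set Fin cols).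
record BinMatrix : Set where
  constructor mkBin
  field
    rows  : ℕ
    cols  : ℕ
    entry : Fin rows → Fin cols → Bool
open BinMatrix public

Indep : (A : BinMatrix) → FSet (cols A) → Set
Indep A I = ∀ (T : FSet (cols A)) → T ⊆ I →
  (∀ k → xorSum (λ j → T j ∧ entry A k j) ≡ false) → IsEmpty T

BasisOf : (A : BinMatrix) → FSet (cols A) → FSet (cols A) → Set
BasisOf A C J = J ⊆ C × Indep A J ×
  (∀ e → C e ≡ true → J e ≡ false → ¬ Indep A (J ∪ ⁅ e ⁆))

Basis : (A : BinMatrix) → FSet (cols A) → Set
Basis A B = BasisOf A full B

-- Independence in the contraction M/C (on E − C).
ContrIndep : (A : BinMatrix) → FSet (cols A) → FSet (cols A) → Set
ContrIndep A C I = Disjoint I C × Σ (FSet (cols A)) (λ J → BasisOf A C J × Indep A (I ∪ J))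

image : ∀ {m n} → (Fin m → Fin n) → FSet m → FSet n
image σ X e = anyFin (λ i → X i ∧ ⌊ σ i ≟ e ⌋)

-- F is isomorphic to M / C \ D  (C, D disjoint), via a bijection σ from
-- E(F) onto E(M) − (C ∪ D).
IsoMinor : (M : BinMatrix) → FSet (cols M) → FSet (cols M) → BinMatrix → Set
IsoMinor M C D F = Disjoint C D ×
  Σ (Fin (cols F) → Fin (cols M)) (λ σ →
    Injective _≡_ _≡_ σ ×
    (∀ e → (C e ∨ D e ≡ false → ∃ (λ i → σ i ≡ e)) × (∃ (λ i → σ i ≡ e) → C e ∨ D e ≡ false)) ×
    (∀ (X : FSet (cols F)) →
       (Indep F X → ContrIndep M C (image σ X)) × (ContrIndep M C (image σ X) → Indep F X)))

HasMinor : BinMatrix → BinMatrix → Set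
HasMinor M F = Σ (FSet (cols M)) (λ C → Σ (FSet (cols M)) (λ D → IsoMinor M C D F))

-- {x,y} (x ≠ y) is a 2-element cocircuit of N: a minimal set meeting every basis.
Cocircuit2 : (N : BinMatrix) → Fin (cols N) → Fin (cols N) → Set
Cocircuit2 N x y =
  (∀ B → Basis N B → B x ∨ B y ≡ true) ×
  Σ (FSet (cols N)) (λ B → Basis N B × B x ≡ false) ×
  Σ (FSet (cols N)) (λ B → Basis N B × B y ≡ false)

InTilde : BinMatrix → BinMatrix → Set
InTilde F N = Σ (Fin (cols N)) (λ x → Σ (Fin (cols N)) (λ y → x ≢ y ×
  (IsoMinor N ∅ (pair x y) F
   ⊎ (Cocircuit2 N x y × IsoMinor N ⁅ x ⁆ ∅ F)
   ⊎ (Cocircuit2 N x y × IsoMinor N (pair x y) ∅ F))))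

splitRow : ∀ {r n} → (Fin r → Fin n → Bool) → Fin n → Fin n → Fin (suc r) → Fin n → Bool
splitRow A x y zero    j = ⌊ j ≟ x ⌋ ∨ ⌊ j ≟ y ⌋
splitRow A x y (suc k) j = A k j

split : (M : BinMatrix) → Fin (cols M) → Fin (cols M) → BinMatrix
split M x y = mkBin (suc (rows M)) (cols M) (splitRow (entry M) x y)

-- Let N ∈ F̃ be the minor M / C \ D, identified with it by σ, and let F = N / Cx \ Dx be the
-- minor of N given by the pair x, y. Composing, F is the minor M / (C ∪ σ Cx) \ (D ∪ σ Dx), and
-- it is also that minor of the splitting matroid M_{σx,σy}: a minor only depends on the
-- independent sets avoiding the deleted elements, and the extra row of the splitting matrix only
-- destroys independent sets containing a cycle that meets {σx, σy} in one element. Among the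
-- cycles avoiding the deleted elements there is no such cycle: if {x, y} is deleted they miss σx
-- and σy altogether, and if {x, y} is a cocircuit of N they meet it evenly, as cycles and
-- cocircuits of a binary matroid do.

module Submission where

open import Algebra.Bundles using (CommutativeRing)
open import Data.Bool using (Bool; true; false; _∧_; _∨_; _xor_; not)
open import Data.Bool.Properties
  using ( ¬-not; not-involutive; ∨-comm; ∨-identityʳ; ∨-conicalˡ; ∨-conicalʳ; ∧-comm; ∧-identityʳ
        ; ∧-zeroʳ; ∧-conicalˡ; ∧-conicalʳ; ∧-distribˡ-xor; ∧-distribʳ-xor; xor-same; xor-identityʳ
        ; xor-∧-commutativeRing)
  renaming (_≟_ to _≟ᵇ_)
open import Algebra.Properties.CommutativeSemigroup
  (CommutativeRing.+-commutativeSemigroup xor-∧-commutativeRing) using (interchange)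
open import Data.Empty using (⊥; ⊥-elim)
open import Data.Fin using (Fin; zero; suc; _≟_)
open import Data.Fin.Properties using (all?; suc-injective)
open import Data.Fin.Subset.Properties using (anySubset?)
open import Data.Nat using (ℕ; zero; suc)
open import Data.Product using (Σ; _×_; _,_; ∃; proj₁; proj₂; swap)
open import Data.Sum using (_⊎_; inj₁; inj₂)
open import Data.Vec using (lookup; tabulate)
open import Data.Vec.Properties using (lookup∘tabulate)
open import Function.Definitions using (Injective)
open import Relation.Binary.PropositionalEquality
  using (_≡_; _≢_; refl; sym; trans; cong; cong₂; subst; module ≡-Reasoning)
open import Relation.Nullary using (¬_; Dec; yes; no)
open import Relation.Nullary.Decidable using (map′; _×-dec_; _→-dec_)

open import Defs

≡true⇒≢false : ∀ {a} → a ≡ true → a ≢ false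
≡true⇒≢false refl ()

∨-≡true⁻ : ∀ a b → a ∨ b ≡ true → a ≡ true ⊎ b ≡ true
∨-≡true⁻ true  b _ = inj₁ refl
∨-≡true⁻ false b p = inj₂ p

∨-≡trueˡ : ∀ {a} b → a ≡ true → a ∨ b ≡ true
∨-≡trueˡ b refl = refl

∨-≡trueʳ : ∀ a {b} → b ≡ true → a ∨ b ≡ true
∨-≡trueʳ true  _    = refl
∨-≡trueʳ false refl = refl

∨-≡false : ∀ {a b} → a ≡ false → b ≡ false → a ∨ b ≡ false
∨-≡false refl refl = refl

∧-≡true : ∀ {a b} → a ≡ true → b ≡ true → a ∧ b ≡ true
∧-≡true refl refl = refl

xor-≡true⁻ : ∀ a b → a xor b ≡ true → (a ≡ true × b ≡ false) ⊎ (a ≡ false × b ≡ true)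
xor-≡true⁻ true  false _ = inj₁ (refl , refl)
xor-≡true⁻ false true  _ = inj₂ (refl , refl)

xor-≡false⇒≡ : ∀ a b → a xor b ≡ false → a ≡ b
xor-≡false⇒≡ true  true  _ = refl
xor-≡false⇒≡ false false _ = refl

xor-solveʳ : ∀ s a e → s xor a ≡ e → a ≡ s xor e
xor-solveʳ true  a e refl = sym (not-involutive a)
xor-solveʳ false a e p = p

≡-by-cases : ∀ a b → (a ≡ true → b ≡ true) → (b ≡ true → a ≡ true) → a ≡ b
≡-by-cases true  _     p _ = sym (p refl)
≡-by-cases false true  _ q = q refl
≡-by-cases false false _ _ = refl

⁅⁆-self : ∀ {n} (a : Fin n) → ⁅ a ⁆ a ≡ true
⁅⁆-self a with a ≟ a
... | yes _   = refl
... | no a≢a = ⊥-elim (a≢a refl)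

⁅⁆-other : ∀ {n} {a j : Fin n} → j ≢ a → ⁅ a ⁆ j ≡ false
⁅⁆-other {a = a} {j} j≢a with j ≟ a
... | yes j≡a = ⊥-elim (j≢a j≡a)
... | no _    = refl

⁅⁆-≡ : ∀ {n} {a j : Fin n} → ⁅ a ⁆ j ≡ true → j ≡ a
⁅⁆-≡ {a = a} {j} p with j ≟ a
... | yes j≡a = j≡a

_⊕_ : ∀ {n} → FSet n → FSet n → FSet n
(X ⊕ Y) e = X e xor Y e

_∖_ : ∀ {n} → FSet n → Fin n → FSet n
(X ∖ a) e = X e ∧ not (⁅ a ⁆ e)

module _ {n : ℕ} where

  ⊆-refl : {X : FSet n} → X ⊆ X
  ⊆-refl _ p = p

  ⊆-trans : {X Y Z : FSet n} → X ⊆ Y → Y ⊆ Z → X ⊆ Z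
  ⊆-trans p q e r = q e (p e r)

  X⊆X∪Y : {X Y : FSet n} → X ⊆ (X ∪ Y)
  X⊆X∪Y {Y = Y} e p = ∨-≡trueˡ (Y e) p

  Y⊆X∪Y : {X Y : FSet n} → Y ⊆ (X ∪ Y)
  Y⊆X∪Y {X = X} e p = ∨-≡trueʳ (X e) p

  ∪-lub : {X Y Z : FSet n} → X ⊆ Z → Y ⊆ Z → (X ∪ Y) ⊆ Z
  ∪-lub {X} {Y} p q e r with ∨-≡true⁻ (X e) (Y e) r
  ... | inj₁ Xe = p e Xe
  ... | inj₂ Ye = q e Ye

  ∪-mono : {X Y X′ Y′ : FSet n} → X ⊆ X′ → Y ⊆ Y′ → (X ∪ Y) ⊆ (X′ ∪ Y′)
  ∪-mono p q = ∪-lub (⊆-trans p X⊆X∪Y) (⊆-trans q Y⊆X∪Y)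

  ⊕-⊆ : {X Y S : FSet n} → X ⊆ S → Y ⊆ S → (X ⊕ Y) ⊆ S
  ⊕-⊆ {X} {Y} p q e r with xor-≡true⁻ (X e) (Y e) r
  ... | inj₁ (Xe , _) = p e Xe
  ... | inj₂ (_ , Ye) = q e Ye

  ⁅⁆-⊆ : {X : FSet n} {a : Fin n} → X a ≡ true → ⁅ a ⁆ ⊆ X
  ⁅⁆-⊆ Xa e r rewrite ⁅⁆-≡ r = Xa

  Disjoint-⊇ : {X D D′ : FSet n} → D ⊆ D′ → Disjoint X D′ → Disjoint X D
  Disjoint-⊇ D⊆D′ disj e Xe = ¬-not (λ De → ≡true⇒≢false (D⊆D′ e De) (disj e Xe))

  ∪⁅⁆-≢ : {X : FSet n} {a e : Fin n} → (X ∪ ⁅ a ⁆) e ≡ true → e ≢ a → X e ≡ true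
  ∪⁅⁆-≢ {X} {a} {e} r e≢a with ∨-≡true⁻ (X e) (⁅ a ⁆ e) r
  ... | inj₁ Xe = Xe
  ... | inj₂ ae = ⊥-elim (e≢a (⁅⁆-≡ ae))

  Disjoint-∪ : {X Y D : FSet n} → Disjoint X D → Disjoint Y D → Disjoint (X ∪ Y) D
  Disjoint-∪ {X} {Y} X∩D Y∩D e r with ∨-≡true⁻ (X e) (Y e) r
  ... | inj₁ Xe = X∩D e Xe
  ... | inj₂ Ye = Y∩D e Ye

  Disjoint-⊆ : {X Y D : FSet n} → X ⊆ Y → Disjoint Y D → Disjoint X D
  Disjoint-⊆ p disj e r = disj e (p e r)

  ∖-⊆ : {X : FSet n} {a : Fin n} → (X ∖ a) ⊆ X
  ∖-⊆ {X} e r = ∧-conicalˡ (X e) _ r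

  ∖-self : (X : FSet n) (a : Fin n) → (X ∖ a) a ≡ false
  ∖-self X a rewrite ⁅⁆-self a = ∧-zeroʳ (X a)

  ∖-intro : {X : FSet n} {a i : Fin n} → X i ≡ true → i ≢ a → (X ∖ a) i ≡ true
  ∖-intro Xi i≢a rewrite Xi | ⁅⁆-other i≢a = refl

  ∖-≢ : {X : FSet n} {a i : Fin n} → (X ∖ a) i ≡ true → i ≢ a
  ∖-≢ {X} {a} {i} r refl = ≡true⇒≢false r (∖-self X a)

  ⊆-∖ : {X : FSet n} {a : Fin n} → X a ≡ false → X ⊆ (X ∖ a)
  ⊆-∖ {X} Xa i Xi = ∖-intro {X} Xi (λ { refl → ≡true⇒≢false Xi Xa })

  ∖-⊆-∪⁅⁆ : {X S : FSet n} {a : Fin n} → X ⊆ (S ∪ ⁅ a ⁆) → (X ∖ a) ⊆ S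
  ∖-⊆-∪⁅⁆ {X} {S} {a} p i r with ∨-≡true⁻ (S i) (⁅ a ⁆ i) (p i (∖-⊆ {X} i r))
  ... | inj₁ Si = Si
  ... | inj₂ ai = ⊥-elim (∖-≢ {X} r (⁅⁆-≡ ai))

  ⊆-∖∪⁅⁆ : {X : FSet n} {a : Fin n} → X ⊆ ((X ∖ a) ∪ ⁅ a ⁆)
  ⊆-∖∪⁅⁆ {X} {a} i Xi with i ≟ a
  ... | yes refl = ∨-≡trueʳ _ refl
  ... | no  _    = ∨-≡trueˡ _ (∧-≡true Xi refl)

  ∖-⊕⁅⁆ : {X : FSet n} {a : Fin n} → X a ≡ true → ∀ i → X i ≡ ((X ∖ a) ⊕ ⁅ a ⁆) i
  ∖-⊕⁅⁆ {X} {a} Xa i =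
    decompose (X i) (⁅ a ⁆ i) (λ ai → subst (λ j → X j ≡ true) (sym (⁅⁆-≡ ai)) Xa)
    where
    decompose : ∀ x s → (s ≡ true → x ≡ true) → x ≡ (x ∧ not s) xor s
    decompose x     false _ = sym (trans (xor-identityʳ _) (∧-identityʳ x))
    decompose false true  p = p refl
    decompose true  true  _ = refl

anyFin-elim : ∀ {n} (f : Fin n → Bool) → anyFin f ≡ true → ∃ λ i → f i ≡ true
anyFin-elim {suc n} f p with ∨-≡true⁻ (f zero) _ p
... | inj₁ f0 = zero , f0
... | inj₂ fs with anyFin-elim (λ i → f (suc i)) fs
... | i , fi = suc i , fi

anyFin-intro : ∀ {n} (f : Fin n → Bool) i → f i ≡ true → anyFin f ≡ true
anyFin-intro f zero    fi = ∨-≡trueˡ _ fi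
anyFin-intro f (suc i) fi = ∨-≡trueʳ (f zero) (anyFin-intro (λ j → f (suc j)) i fi)

module _ {m n} (σ : Fin m → Fin n) where

  image-elim : ∀ {X e} → image σ X e ≡ true → ∃ λ i → X i ≡ true × σ i ≡ e
  image-elim {X} p with anyFin-elim _ p
  ... | i , q = i , ∧-conicalˡ (X i) _ q , ⁅⁆-≡ (∧-conicalʳ (X i) _ q)

  image-intro : ∀ {X i e} → X i ≡ true → σ i ≡ e → image σ X e ≡ true
  image-intro {i = i} Xi refl = anyFin-intro _ i (∧-≡true Xi (⁅⁆-self (σ i)))

  image-mono : ∀ {X Y} → X ⊆ Y → image σ X ⊆ image σ Y
  image-mono X⊆Y e r with image-elim r
  ... | i , Xi , σi≡e = image-intro (X⊆Y i Xi) σi≡e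

  image-∪ : ∀ {X Y} → image σ (X ∪ Y) ⊆ (image σ X ∪ image σ Y)
  image-∪ {X} {Y} e r with image-elim r
  ... | i , XYi , σi≡e with ∨-≡true⁻ (X i) (Y i) XYi
  ... | inj₁ Xi = X⊆X∪Y {X = image σ X} {Y = image σ Y} e (image-intro Xi σi≡e)
  ... | inj₂ Yi = Y⊆X∪Y {X = image σ X} {Y = image σ Y} e (image-intro Yi σi≡e)

  image-⁅⁆ : ∀ {i} → image σ ⁅ i ⁆ ⊆ ⁅ σ i ⁆
  image-⁅⁆ {i} e r with image-elim r
  ... | j , j≡i , refl rewrite ⁅⁆-≡ j≡i = ⁅⁆-self (σ i)

  ⁅⁆-image : ∀ {i} → ⁅ σ i ⁆ ⊆ image σ ⁅ i ⁆
  ⁅⁆-image {i} e r = image-intro (⁅⁆-self i) (sym (⁅⁆-≡ r))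

  image-Disjoint : ∀ {X D} → (∀ i → D (σ i) ≡ false) → Disjoint (image σ X) D
  image-Disjoint σ∉D e r with image-elim r
  ... | i , _ , refl = σ∉D i

  image-σ : Injective _≡_ _≡_ σ → ∀ X i → image σ X (σ i) ≡ X i
  image-σ inj X i = ≡-by-cases _ _ (λ r → from (image-elim r)) (λ Xi → image-intro Xi refl)
    where
    from : (∃ λ j → X j ≡ true × σ j ≡ σ i) → X i ≡ true
    from (j , Xj , σj≡σi) rewrite inj σj≡σi = Xj

module _ {l m n} (σ : Fin m → Fin n) (τ : Fin l → Fin m) {X : FSet l} where

  image-∘ : image (λ i → σ (τ i)) X ⊆ image σ (image τ X)
  image-∘ e r with image-elim (λ i → σ (τ i)) r
  ... | i , Xi , στi≡e = image-intro σ (image-intro τ Xi refl) στi≡e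

  image-∘⁻ : image σ (image τ X) ⊆ image (λ i → σ (τ i)) X
  image-∘⁻ e r with image-elim σ r
  ... | j , τXj , σj≡e with image-elim τ τXj
  ... | i , Xi , refl = image-intro (λ i → σ (τ i)) Xi σj≡e

-- Linear algebra over GF(2)

xorSum-cong : ∀ {n} {f g : Fin n → Bool} → (∀ i → f i ≡ g i) → xorSum f ≡ xorSum g
xorSum-cong {zero}  _ = refl
xorSum-cong {suc n} p = cong₂ _xor_ (p zero) (xorSum-cong (λ i → p (suc i)))

xorSum-zero : ∀ {n} {f : Fin n → Bool} → (∀ i → f i ≡ false) → xorSum f ≡ false
xorSum-zero {zero}  _ = refl
xorSum-zero {suc n} p rewrite p zero = xorSum-zero (λ i → p (suc i))

xorSum-xor : ∀ {n} (f g : Fin n → Bool) → xorSum (λ i → f i xor g i) ≡ xorSum f xor xorSum g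
xorSum-xor {zero}  f g = refl
xorSum-xor {suc n} f g =
  trans (cong ((f zero xor g zero) xor_) (xorSum-xor (λ i → f (suc i)) (λ i → g (suc i))))
        (interchange (f zero) (g zero) _ _)

xorSum-supported : ∀ {n} (f : Fin n → Bool) a → (∀ j → j ≢ a → f j ≡ false) → xorSum f ≡ f a
xorSum-supported f zero p =
  trans (cong (f zero xor_) (xorSum-zero (λ j → p (suc j) (λ ())))) (xor-identityʳ (f zero))
xorSum-supported f (suc a) p rewrite p zero (λ ()) =
  xorSum-supported (λ j → f (suc j)) a (λ j j≢a → p (suc j) (λ sj≡sa → j≢a (suc-injective sj≡sa)))

xorSum-⁅⁆ : ∀ {n} (f : Fin n → Bool) a → xorSum (λ j → ⁅ a ⁆ j ∧ f j) ≡ f a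
xorSum-⁅⁆ f a = trans (xorSum-supported _ a (λ j j≢a → cong (_∧ f j) (⁅⁆-other j≢a)))
                      (cong (_∧ f a) (⁅⁆-self a))

module _ {r : ℕ} (P : (Fin r → Bool) → Set)
  (P-cong : ∀ {u v} → (∀ k → u k ≡ v k) → P u → P v)
  (P-zero : P (λ _ → false))
  (P-xor : ∀ {u v} → P u → P v → P (λ k → u k xor v k)) where

  xorSum-closed : ∀ {n} (X : Fin n → Bool) (f : Fin n → Fin r → Bool) →
                  (∀ i → X i ≡ true → P (f i)) → P (λ k → xorSum (λ i → X i ∧ f i k))
  xorSum-closed {zero}  X f h = P-zero
  xorSum-closed {suc n} X f h with X zero in X0
  ... | true  = P-xor (h zero X0) rest
    where rest = xorSum-closed (λ i → X (suc i)) (λ i → f (suc i)) (λ i → h (suc i))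
  ... | false = xorSum-closed (λ i → X (suc i)) (λ i → f (suc i)) (λ i → h (suc i))

module _ (A : BinMatrix) where

  colSum : FSet (cols A) → Fin (rows A) → Bool
  colSum T k = xorSum (λ j → T j ∧ entry A k j)

  col : Fin (cols A) → Fin (rows A) → Bool
  col e k = entry A k e

  Cycle : FSet (cols A) → Set
  Cycle T = ∀ k → colSum T k ≡ false

  Span : FSet (cols A) → (Fin (rows A) → Bool) → Set
  Span S v = Σ (FSet (cols A)) λ R → R ⊆ S × (∀ k → colSum R k ≡ v k)

  colSum-cong : ∀ {X Y} → (∀ e → X e ≡ Y e) → ∀ k → colSum X k ≡ colSum Y k
  colSum-cong p k = xorSum-cong (λ j → cong (_∧ entry A k j) (p j))

  colSum-⊕ : ∀ X Y k → colSum (X ⊕ Y) k ≡ colSum X k xor colSum Y k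
  colSum-⊕ X Y k =
    trans (xorSum-cong (λ j → ∧-distribʳ-xor (entry A k j) (X j) (Y j)))
          (xorSum-xor (λ j → X j ∧ entry A k j) (λ j → Y j ∧ entry A k j))

  colSum-⁅⁆ : ∀ e k → colSum ⁅ e ⁆ k ≡ col e k
  colSum-⁅⁆ e k = xorSum-⁅⁆ (λ j → entry A k j) e

  colSum-∖ : ∀ {X e} → X e ≡ true → ∀ k → colSum X k ≡ colSum (X ∖ e) k xor col e k
  colSum-∖ {X} {e} Xe k = begin
    colSum X k                              ≡⟨ colSum-cong (∖-⊕⁅⁆ Xe) k ⟩
    colSum ((X ∖ e) ⊕ ⁅ e ⁆) k              ≡⟨ colSum-⊕ (X ∖ e) ⁅ e ⁆ k ⟩
    colSum (X ∖ e) k xor colSum ⁅ e ⁆ k     ≡⟨ cong (colSum (X ∖ e) k xor_) (colSum-⁅⁆ e k) ⟩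
    colSum (X ∖ e) k xor col e k            ∎
    where open ≡-Reasoning

  Indep-⊆ : ∀ {I J} → J ⊆ I → Indep A I → Indep A J
  Indep-⊆ J⊆I indI T T⊆J = indI T (⊆-trans T⊆J J⊆I)

  Indep-∅ : Indep A ∅
  Indep-∅ T T⊆∅ _ e = ¬-not (λ Te → ≡true⇒≢false (T⊆∅ e Te) refl)

  span-cong : ∀ {S u v} → (∀ k → u k ≡ v k) → Span S u → Span S v
  span-cong u≗v (R , R⊆S , sum) = R , R⊆S , λ k → trans (sum k) (u≗v k)

  span-mono : ∀ {S S′ v} → S ⊆ S′ → Span S v → Span S′ v
  span-mono S⊆S′ (R , R⊆S , sum) = R , ⊆-trans R⊆S S⊆S′ , sum

  span-colSum : ∀ {S T} → T ⊆ S → Span S (colSum T)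
  span-colSum T⊆S = _ , T⊆S , λ _ → refl

  span-col : ∀ {S e} → S e ≡ true → Span S (col e)
  span-col {e = e} Se = ⁅ e ⁆ , ⁅⁆-⊆ Se , colSum-⁅⁆ e

  span-zero : ∀ {S} → Span S (λ _ → false)
  span-zero = ∅ , (λ _ ()) , λ _ → xorSum-zero {cols A} (λ _ → refl)

  span-xor : ∀ {S u v} → Span S u → Span S v → Span S (λ k → u k xor v k)
  span-xor (R , R⊆S , sum) (R′ , R′⊆S , sum′) =
    R ⊕ R′ , ⊕-⊆ R⊆S R′⊆S , λ k → trans (colSum-⊕ R R′ k) (cong₂ _xor_ (sum k) (sum′ k))

  span-trans : ∀ {S S′ v} → (∀ e → S e ≡ true → Span S′ (col e)) → Span S v → Span S′ v
  span-trans {S′ = S′} spanned (R , R⊆S , sum) =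
    span-cong sum (xorSum-closed (Span S′) span-cong span-zero span-xor R
                                 (λ i k → entry A k i) (λ i Ri → spanned i (R⊆S i Ri)))

  cycle-span : ∀ {T e} → Cycle T → T e ≡ true → Span (T ∖ e) (col e)
  cycle-span {T} {e} cyc Te =
    T ∖ e , ⊆-refl , λ k → xor-≡false⇒≡ _ _ (trans (sym (colSum-∖ Te k)) (cyc k))

  Indep-∪⁅⁆ : ∀ {S e} → Indep A S → ¬ Span S (col e) → Indep A (S ∪ ⁅ e ⁆)
  Indep-∪⁅⁆ {S} {e} indS e∉span T T⊆ cyc with T e in Te
  ... | true  = ⊥-elim (e∉span (span-mono (∖-⊆-∪⁅⁆ T⊆) (cycle-span cyc Te)))
  ... | false = indS T (⊆-trans (⊆-∖ Te) (∖-⊆-∪⁅⁆ T⊆)) cyc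

  span⇒¬Indep-∪⁅⁆ : ∀ {S e} → Span S (col e) → S e ≡ false → ¬ Indep A (S ∪ ⁅ e ⁆)
  span⇒¬Indep-∪⁅⁆ {S} {e} (R , R⊆S , sum) Se indSe =
    ≡true⇒≢false Te (indSe T (⊕-⊆ (⊆-trans R⊆S X⊆X∪Y) Y⊆X∪Y) cyc e)
    where
    T = R ⊕ ⁅ e ⁆
    Re : R e ≡ false
    Re = ¬-not (λ Re → ≡true⇒≢false (R⊆S e Re) Se)
    Te : T e ≡ true
    Te rewrite Re = ⁅⁆-self e
    cyc : Cycle T
    cyc k = trans (colSum-⊕ R ⁅ e ⁆ k)
                  (trans (cong₂ _xor_ (sum k) (colSum-⁅⁆ e k)) (xor-same (col e k)))

  span-exchange : ∀ {W a e} → Span (W ∪ ⁅ a ⁆) (col e) → ¬ Span W (col e) → Span (W ∪ ⁅ e ⁆) (col a)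
  span-exchange {W} {a} {e} (R , R⊆ , sum) e∉spanW with R a in Ra
  ... | false = ⊥-elim (e∉spanW (R , ⊆-trans (⊆-∖ Ra) (∖-⊆-∪⁅⁆ R⊆) , sum))
  ... | true  = span-cong (λ k → sym (xor-solveʳ (colSum (R ∖ a) k) (col a k) (col e k)
                                                  (trans (sym (colSum-∖ Ra k)) (sum k))))
                          (span-xor (span-colSum (⊆-trans (∖-⊆-∪⁅⁆ {X = R} R⊆) (X⊆X∪Y {Y = ⁅ e ⁆})))
                                    (span-col (Y⊆X∪Y {X = W} {Y = ⁅ e ⁆} e (⁅⁆-self e))))

any-FSet? : ∀ {n} (Q : FSet n → Set) → (∀ {X Y} → (∀ e → X e ≡ Y e) → Q X → Q Y) →
            (∀ X → Dec (Q X)) → Dec (Σ (FSet n) Q)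
any-FSet? Q resp Q? =
  map′ (λ (V , q) → lookup V , q)
       (λ (X , q) → tabulate X , resp (λ e → sym (lookup∘tabulate X e)) q)
       (anySubset? (λ V → Q? (lookup V)))

_⊆?_ : ∀ {n} (X Y : FSet n) → Dec (X ⊆ Y)
X ⊆? Y = all? (λ e → (X e ≟ᵇ true) →-dec (Y e ≟ᵇ true))

module _ (A : BinMatrix) where

  Span? : ∀ S v → Dec (Span A S v)
  Span? S v = any-FSet? _ resp (λ R → (R ⊆? S) ×-dec all? (λ k → colSum A R k ≟ᵇ v k))
    where
    resp : ∀ {R R′} → (∀ e → R e ≡ R′ e) → R ⊆ S × (∀ k → colSum A R k ≡ v k) →
           R′ ⊆ S × (∀ k → colSum A R′ k ≡ v k)
    resp R≗R′ (R⊆S , sum) = (λ e R′e → R⊆S e (trans (R≗R′ e) R′e)) ,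
                            λ k → trans (sym (colSum-cong A R≗R′ k)) (sum k)

  ¬Indep-∪⁅⁆⇒span : ∀ {S e} → Indep A S → ¬ Indep A (S ∪ ⁅ e ⁆) → Span A S (col A e)
  ¬Indep-∪⁅⁆⇒span {S} {e} indS dep with Span? S (col A e)
  ... | yes spanned = spanned
  ... | no  e∉span  = ⊥-elim (dep (Indep-∪⁅⁆ A indS e∉span))

  basis-span : ∀ {C J e} → BasisOf A C J → C e ≡ true → Span A J (col A e)
  basis-span {J = J} {e} (_ , indJ , maximal) Ce with J e in Je
  ... | true  = span-col A Je
  ... | false = ¬Indep-∪⁅⁆⇒span indJ (maximal e Ce Je)

  -- The part of a cycle lying in J₀ is re-expressed through the basis J that witnesses
  -- independence of Z in the contraction; this turns the part of the cycle in Z into a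
  -- cycle in Z ∪ J, which is therefore empty.
  ContrIndep⇒Indep-∪ : ∀ {C J₀ Z} → BasisOf A C J₀ → ContrIndep A C Z → Indep A (Z ∪ J₀)
  ContrIndep⇒Indep-∪ {C} {J₀} {Z} (J₀⊆C , indJ₀ , _) (Z∩C≡∅ , J , basJ , indZ∪J) T T⊆ cyc =
    indJ₀ T T⊆J₀ cyc
    where
    TZ TJ : FSet (cols A)
    TZ e = T e ∧ Z e
    TJ e = T e ∧ J₀ e

    T≗TZ⊕TJ : ∀ e → T e ≡ (TZ ⊕ TJ) e
    T≗TZ⊕TJ e = decompose (T e) (Z e) (J₀ e) (T⊆ e)
                  (λ Ze → ¬-not (λ J₀e → ≡true⇒≢false (J₀⊆C e J₀e) (Z∩C≡∅ e Ze)))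
      where
      decompose : ∀ t z j → (t ≡ true → z ∨ j ≡ true) → (z ≡ true → j ≡ false) →
                  t ≡ (t ∧ z) xor (t ∧ j)
      decompose false z     j     _ _ = refl
      decompose true  true  false _ _ = refl
      decompose true  false true  _ _ = refl
      decompose true  false false p _ with () ← p refl
      decompose true  true  true  _ q with () ← q refl

    spanTJ : Span A J (colSum A TJ)
    spanTJ = span-trans A (λ e TJe → basis-span basJ (J₀⊆C e (∧-conicalʳ (T e) _ TJe)))
                          (span-colSum A ⊆-refl)
    R = proj₁ spanTJ

    U : FSet (cols A)
    U = TZ ⊕ R

    U⊆Z∪J : U ⊆ (Z ∪ J)
    U⊆Z∪J = ⊕-⊆ {X = TZ} (λ e TZe → X⊆X∪Y {X = Z} {Y = J} e (∧-conicalʳ (T e) _ TZe))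
                (⊆-trans (proj₁ (proj₂ spanTJ)) (Y⊆X∪Y {X = Z}))

    U-cycle : Cycle A U
    U-cycle k = begin
      colSum A U k                      ≡⟨ colSum-⊕ A TZ R k ⟩
      colSum A TZ k xor colSum A R k    ≡⟨ cong (colSum A TZ k xor_) (proj₂ (proj₂ spanTJ) k) ⟩
      colSum A TZ k xor colSum A TJ k   ≡⟨ sym (colSum-⊕ A TZ TJ k) ⟩
      colSum A (TZ ⊕ TJ) k              ≡⟨ sym (colSum-cong A T≗TZ⊕TJ k) ⟩
      colSum A T k                      ≡⟨ cyc k ⟩
      false                             ∎
      where open ≡-Reasoning

    TZ≡∅ : ∀ e → TZ e ≡ false
    TZ≡∅ e with TZ e in TZe
    ... | false = refl
    ... | true  = ⊥-elim (≡true⇒≢false Ue (indZ∪J U U⊆Z∪J U-cycle e))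
      where
      Re : R e ≡ false
      Re = ¬-not (λ Re → ≡true⇒≢false (proj₁ basJ e (proj₁ (proj₂ spanTJ) e Re))
                                      (Z∩C≡∅ e (∧-conicalʳ (T e) _ TZe)))
      Ue : U e ≡ true
      Ue rewrite TZe | Re = refl

    T⊆J₀ : T ⊆ J₀
    T⊆J₀ e Te with ∨-≡true⁻ (Z e) (J₀ e) (T⊆ e Te)
    ... | inj₂ J₀e = J₀e
    ... | inj₁ Ze  = ⊥-elim (≡true⇒≢false (∧-≡true Te Ze) (TZ≡∅ e))

module _ (M : BinMatrix) {a b : Fin (cols M)} where

  colSum-splitRow : a ≢ b → ∀ T → colSum (split M a b) T zero ≡ T a xor T b
  colSum-splitRow a≢b T = begin
    xorSum (λ j → T j ∧ (⁅ a ⁆ j ∨ ⁅ b ⁆ j))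
      ≡⟨ xorSum-cong (λ j → cong (T j ∧_) (∨≡xor j)) ⟩
    xorSum (λ j → T j ∧ (⁅ a ⁆ j xor ⁅ b ⁆ j))
      ≡⟨ xorSum-cong (λ j → distrib (T j) (⁅ a ⁆ j) (⁅ b ⁆ j)) ⟩
    xorSum (λ j → (⁅ a ⁆ j ∧ T j) xor (⁅ b ⁆ j ∧ T j))
      ≡⟨ xorSum-xor (λ j → ⁅ a ⁆ j ∧ T j) (λ j → ⁅ b ⁆ j ∧ T j) ⟩
    xorSum (λ j → ⁅ a ⁆ j ∧ T j) xor xorSum (λ j → ⁅ b ⁆ j ∧ T j)
      ≡⟨ cong₂ _xor_ (xorSum-⁅⁆ T a) (xorSum-⁅⁆ T b) ⟩
    T a xor T b
      ∎
    where
    open ≡-Reasoning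
    ∨≡xor : ∀ j → ⁅ a ⁆ j ∨ ⁅ b ⁆ j ≡ ⁅ a ⁆ j xor ⁅ b ⁆ j
    ∨≡xor j with ⁅ a ⁆ j in aj | ⁅ b ⁆ j in bj
    ... | true  | true  = ⊥-elim (a≢b (trans (sym (⁅⁆-≡ aj)) (⁅⁆-≡ bj)))
    ... | true  | false = refl
    ... | false | _     = refl
    distrib : ∀ t p q → t ∧ (p xor q) ≡ (p ∧ t) xor (q ∧ t)
    distrib t p q = trans (∧-distribˡ-xor t p q) (cong₂ _xor_ (∧-comm t p) (∧-comm t q))

  Indep-split : ∀ {S} → Indep M S → Indep (split M a b) S
  Indep-split indS T T⊆S cyc = indS T T⊆S (λ k → cyc (suc k))

  Indep-split⁻ : a ≢ b → ∀ {S} → Indep (split M a b) S →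
                 (∀ T → T ⊆ S → Cycle M T → T a ≡ T b) → Indep M S
  Indep-split⁻ a≢b indS even T T⊆S cyc = indS T T⊆S λ
    { zero    → trans (colSum-splitRow a≢b T)
                      (trans (cong (T a xor_) (sym (even T T⊆S cyc))) (xor-same (T a)))
    ; (suc k) → cyc k }

-- Minors

IndepAgreeOff : ∀ {n r r′} → (Fin r → Fin n → Bool) → (Fin r′ → Fin n → Bool) → FSet n → Set
IndepAgreeOff {n} {r} {r′} E E′ D = ∀ U → Disjoint U D →
  (Indep (mkBin r n E) U → Indep (mkBin r′ n E′) U) ×
  (Indep (mkBin r′ n E′) U → Indep (mkBin r n E) U)

module _ {n r r′} {E : Fin r → Fin n → Bool} {E′ : Fin r′ → Fin n → Bool} {D : FSet n} where

  IndepAgreeOff-sym : IndepAgreeOff E E′ D → IndepAgreeOff E′ E D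
  IndepAgreeOff-sym agree U U∩D = swap (agree U U∩D)

  BasisOf-transfer : IndepAgreeOff E E′ D → ∀ {C J} → Disjoint C D →
                     BasisOf (mkBin r n E) C J → BasisOf (mkBin r′ n E′) C J
  BasisOf-transfer agree C∩D (J⊆C , indJ , maximal) =
    J⊆C , proj₁ (agree _ (Disjoint-⊆ J⊆C C∩D)) indJ ,
    λ e Ce Je indJe → maximal e Ce Je (proj₂ (agree _ (Disjoint-⊆ (∪-lub J⊆C (⁅⁆-⊆ Ce)) C∩D)) indJe)

  ContrIndep-transfer : IndepAgreeOff E E′ D → ∀ {C Z} → Disjoint C D → Disjoint Z D →
                        ContrIndep (mkBin r n E) C Z → ContrIndep (mkBin r′ n E′) C Z
  ContrIndep-transfer agree C∩D Z∩D (Z∩C , J , basJ , indZ∪J) =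
    Z∩C , J , BasisOf-transfer agree C∩D basJ ,
    proj₁ (agree _ (Disjoint-∪ Z∩D (Disjoint-⊆ (proj₁ basJ) C∩D))) indZ∪J

IsoMinor-transfer : ∀ {n r r′} {E : Fin r → Fin n → Bool} {E′ : Fin r′ → Fin n → Bool} {C D F} →
                    IndepAgreeOff E E′ D →
                    IsoMinor (mkBin r n E) C D F → IsoMinor (mkBin r′ n E′) C D F
IsoMinor-transfer {C = C} {D} agree (C∩D , σ , σ-inj , σ-onto , σ-iso) =
  C∩D , σ , σ-inj , σ-onto , λ X →
    (λ indX → ContrIndep-transfer agree C∩D (σX∩D X) (proj₁ (σ-iso X) indX)) ,
    (λ ci → proj₂ (σ-iso X) (ContrIndep-transfer (IndepAgreeOff-sym agree) C∩D (σX∩D X) ci))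
  where
  σX∩D : ∀ X → Disjoint (image σ X) D
  σX∩D X = image-Disjoint σ (λ i → ∨-conicalʳ (C (σ i)) _ (proj₂ (σ-onto (σ i)) (i , refl)))

CyclesMeetEvenly : (A : BinMatrix) → FSet (cols A) → Fin (cols A) → Fin (cols A) → Set
CyclesMeetEvenly A D a b = ∀ T → Disjoint T D → Cycle A T → T a ≡ T b

CyclesMeetEvenly-mono : ∀ {A D D′ a b} → D ⊆ D′ →
                        CyclesMeetEvenly A D a b → CyclesMeetEvenly A D′ a b
CyclesMeetEvenly-mono D⊆D′ even T T∩D′ = even T (Disjoint-⊇ D⊆D′ T∩D′)

split-IsoMinor : ∀ (M : BinMatrix) {a b C D F} → a ≢ b → CyclesMeetEvenly M D a b →
                 IsoMinor M C D F → IsoMinor (split M a b) C D F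
split-IsoMinor M a≢b even = IsoMinor-transfer λ U U∩D →
  Indep-split M ,
  λ indU → Indep-split⁻ M a≢b indU (λ T T⊆U cyc → even T (Disjoint-⊆ T⊆U U∩D) cyc)

module Minor {M N : BinMatrix} {C D : FSet (cols M)} (iso : IsoMinor M C D N) where

  σ : Fin (cols N) → Fin (cols M)
  σ = proj₁ (proj₂ iso)

  σ-inj : Injective _≡_ _≡_ σ
  σ-inj = proj₁ (proj₂ (proj₂ iso))

  σ-onto : ∀ {e} → C e ∨ D e ≡ false → ∃ λ i → σ i ≡ e
  σ-onto {e} = proj₁ (proj₁ (proj₂ (proj₂ (proj₂ iso))) e)

  σ∉C∪D : ∀ i → C (σ i) ∨ D (σ i) ≡ false
  σ∉C∪D i = proj₂ (proj₁ (proj₂ (proj₂ (proj₂ iso))) (σ i)) (i , refl)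

  σ∉C : ∀ i → C (σ i) ≡ false
  σ∉C i = ∨-conicalˡ _ _ (σ∉C∪D i)

  σ∉D : ∀ i → D (σ i) ≡ false
  σ∉D i = ∨-conicalʳ (C (σ i)) _ (σ∉C∪D i)

  contraction : ∀ X → (Indep N X → ContrIndep M C (image σ X)) ×
                      (ContrIndep M C (image σ X) → Indep N X)
  contraction = proj₂ (proj₂ (proj₂ (proj₂ iso)))

  ∪image-σ : ∀ {X} → (∀ i → X (σ i) ≡ false) → ∀ Y j → (X ∪ image σ Y) (σ j) ≡ Y j
  ∪image-σ X∌σ Y j = cong₂ _∨_ (X∌σ j) (image-σ σ σ-inj Y j)

  -- the basis of C that witnesses the independence of ∅ in M / C
  J₀ : FSet (cols M)
  J₀ = proj₁ (proj₂ (proj₁ (contraction ∅) (Indep-∅ N)))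

  J₀-basis : BasisOf M C J₀
  J₀-basis = proj₁ (proj₂ (proj₂ (proj₁ (contraction ∅) (Indep-∅ N))))

  lift : FSet (cols N) → FSet (cols M)
  lift X = image σ X ∪ J₀

  lift-σ : ∀ X i → lift X (σ i) ≡ X i
  lift-σ X i = trans (cong₂ _∨_ (image-σ σ σ-inj X i) J₀∌σi) (∨-identityʳ (X i))
    where
    J₀∌σi : J₀ (σ i) ≡ false
    J₀∌σi = ¬-not (λ J₀σi → ≡true⇒≢false (proj₁ J₀-basis (σ i) J₀σi) (σ∉C i))

  lift-mono : ∀ {X Y} → X ⊆ Y → lift X ⊆ lift Y
  lift-mono X⊆Y = ∪-mono (image-mono σ X⊆Y) ⊆-refl

  lift-∪⁅⁆ : ∀ {X j} → lift (X ∪ ⁅ j ⁆) ⊆ (lift X ∪ ⁅ σ j ⁆)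
  lift-∪⁅⁆ {X} = ∪-lub (⊆-trans (image-∪ σ) (∪-mono (X⊆X∪Y {Y = J₀}) (image-⁅⁆ σ)))
                       (⊆-trans (Y⊆X∪Y {X = image σ X}) X⊆X∪Y)

  ∪⁅⁆-lift : ∀ {X j} → (lift X ∪ ⁅ σ j ⁆) ⊆ lift (X ∪ ⁅ j ⁆)
  ∪⁅⁆-lift {X} = ∪-lub (lift-mono X⊆X∪Y)
                       (⊆-trans (⁅⁆-image σ) (⊆-trans (image-mono σ (Y⊆X∪Y {X = X})) X⊆X∪Y))

  Indep-lift : ∀ {X} → Indep N X → Indep M (lift X)
  Indep-lift {X} indX = ContrIndep⇒Indep-∪ M J₀-basis (proj₁ (contraction X) indX)

  Indep-lift⁻ : ∀ {X} → Indep M (lift X) → Indep N X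
  Indep-lift⁻ {X} ind = proj₂ (contraction X) (image-Disjoint σ σ∉C , J₀ , J₀-basis , ind)

  basis-lift-span : ∀ {B} → Basis N B → ∀ j → Span M (lift B) (col M (σ j))
  basis-lift-span {B} (_ , indB , maximal) j with B j in Bj
  ... | true  = span-col M (trans (lift-σ B j) Bj)
  ... | false = ¬Indep-∪⁅⁆⇒span M (Indep-lift indB)
                  (λ ind → maximal j refl Bj (Indep-lift⁻ (Indep-⊆ M lift-∪⁅⁆ ind)))

  spanning⇒Basis : ∀ {B} → Indep N B → (∀ j → Span M (lift B) (col M (σ j))) → Basis N B
  spanning⇒Basis {B} indB spans = (λ _ _ → refl) , indB , λ f _ Bf indBf →
    span⇒¬Indep-∪⁅⁆ M (spans f) (trans (lift-σ B f) Bf) (Indep-⊆ M ∪⁅⁆-lift (Indep-lift indBf))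

IsoMinor-∘ : ∀ {M N F C D Cx Dx} (iso : IsoMinor M C D N) → IsoMinor N Cx Dx F →
             IsoMinor M (C ∪ image (Minor.σ iso) Cx) (D ∪ image (Minor.σ iso) Dx) F
IsoMinor-∘ {M} {N} {F} {C} {D} {Cx} {Dx} iso isoF =
  C′∩D′ , ρ , (λ p → τ-inj (σ-inj p)) , (λ e → ρ-onto , ρ∉C′∪D′) , contractionF
  where
  open Minor iso
  open Minor isoF using ()
    renaming ( σ to τ; σ-inj to τ-inj; σ-onto to τ-onto; σ∉C∪D to τ∉Cx∪Dx; σ∉C to τ∉Cx
             ; contraction to τ-contraction; J₀ to K; J₀-basis to K-basis)

  C′ D′ : FSet (cols M)
  C′ = C ∪ image σ Cx
  D′ = D ∪ image σ Dx

  ρ : Fin (cols F) → Fin (cols M)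
  ρ i = σ (τ i)

  C′∪D′-σ : ∀ j → C′ (σ j) ∨ D′ (σ j) ≡ Cx j ∨ Dx j
  C′∪D′-σ j = cong₂ _∨_ (∪image-σ {C} σ∉C Cx j) (∪image-σ {D} σ∉D Dx j)

  image∌C : ∀ {Y e} → C e ≡ true → image σ Y e ≡ false
  image∌C Ce = ¬-not (λ r → ≡true⇒≢false Ce (image-Disjoint σ σ∉C _ r))

  C′∩D′ : Disjoint C′ D′
  C′∩D′ e C′e with ∨-≡true⁻ (C e) _ C′e
  ... | inj₁ Ce = ∨-≡false (proj₁ iso e Ce) (image∌C Ce)
  ... | inj₂ r with image-elim σ r
  ...   | j , Cxj , refl = trans (∪image-σ {D} σ∉D Dx j) (proj₁ isoF j Cxj)

  ρ-onto : ∀ {e} → C′ e ∨ D′ e ≡ false → ∃ λ i → ρ i ≡ e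
  ρ-onto {e} p with σ-onto (∨-≡false (∨-conicalˡ (C e) _ (∨-conicalˡ (C′ e) _ p))
                                      (∨-conicalˡ (D e) _ (∨-conicalʳ (C′ e) _ p)))
  ... | j , refl with τ-onto (trans (sym (C′∪D′-σ j)) p)
  ...   | i , τi≡j = i , cong σ τi≡j

  ρ∉C′∪D′ : ∀ {e} → (∃ λ i → ρ i ≡ e) → C′ e ∨ D′ e ≡ false
  ρ∉C′∪D′ (i , refl) = trans (C′∪D′-σ (τ i)) (τ∉Cx∪Dx i)

  liftK-basis : BasisOf M C′ (lift K)
  liftK-basis =
    ∪-lub (⊆-trans (image-mono σ (proj₁ K-basis)) Y⊆X∪Y) (⊆-trans (proj₁ J₀-basis) X⊆X∪Y) ,
    Indep-lift (proj₁ (proj₂ K-basis)) ,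
    maximal
    where
    maximal : ∀ e → C′ e ≡ true → lift K e ≡ false → ¬ Indep M (lift K ∪ ⁅ e ⁆)
    maximal e C′e liftKe ind with ∨-≡true⁻ (C e) _ C′e
    ... | inj₁ Ce = proj₂ (proj₂ J₀-basis) e Ce (∨-conicalʳ (image σ K e) _ liftKe)
                      (Indep-⊆ M (∪-mono (Y⊆X∪Y {X = image σ K}) ⊆-refl) ind)
    ... | inj₂ r with image-elim σ r
    ...   | j , Cxj , refl = proj₂ (proj₂ K-basis) j Cxj (trans (sym (lift-σ K j)) liftKe)
                               (Indep-lift⁻ (Indep-⊆ M lift-∪⁅⁆ ind))

  ρX⊆ : ∀ X → (image ρ X ∪ lift K) ⊆ lift (image τ X ∪ K)
  ρX⊆ X = ∪-lub (⊆-trans (image-∘ σ τ) (⊆-trans (image-mono σ X⊆X∪Y) X⊆X∪Y)) (lift-mono Y⊆X∪Y)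

  ⊆ρX : ∀ X → lift (image τ X ∪ K) ⊆ (image ρ X ∪ lift K)
  ⊆ρX X = ∪-lub (⊆-trans (image-∪ σ) (∪-mono (image-∘⁻ σ τ) X⊆X∪Y))
                (⊆-trans (Y⊆X∪Y {X = image σ K}) (Y⊆X∪Y {X = image ρ X}))

  contractionF : ∀ X → (Indep F X → ContrIndep M C′ (image ρ X)) ×
                       (ContrIndep M C′ (image ρ X) → Indep F X)
  contractionF X =
    (λ indX → image-Disjoint ρ (λ i → trans (∪image-σ {C} σ∉C Cx (τ i)) (τ∉Cx i)) ,
              lift K , liftK-basis ,
              Indep-⊆ M (ρX⊆ X)
                (Indep-lift (ContrIndep⇒Indep-∪ N K-basis (proj₁ (τ-contraction X) indX)))) ,
    (λ ci → proj₂ (τ-contraction X)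
              (image-Disjoint τ τ∉Cx , K , K-basis ,
               Indep-lift⁻ (Indep-⊆ M (⊆ρX X) (ContrIndep⇒Indep-∪ M liftK-basis ci))))

-- Cycles and 2-element cocircuits

-- B is a basis avoiding y, so B ∖ x spans a hyperplane of N: every element other than x and y
-- lies in its span, since otherwise it would complete B ∖ x to a basis avoiding {x, y}.
-- A cycle of M through σ x but not σ y would then put σ x in that span as well.
module CocircuitParity {M N : BinMatrix} {C D : FSet (cols M)} (iso : IsoMinor M C D N)
  {x y : Fin (cols N)} (meets : ∀ B → Basis N B → B x ∨ B y ≡ true)
  {B : FSet (cols N)} (B-basis : Basis N B) (B∌y : B y ≡ false) where

  open Minor iso

  B∋x : B x ≡ true
  B∋x with B x in Bx | meets B B-basis
  ... | true  | _ = refl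
  ... | false | p rewrite B∌y with () ← p

  W : FSet (cols M)
  W = lift (B ∖ x)

  W-indep : Indep M W
  W-indep = Indep-lift (Indep-⊆ N (∖-⊆ {X = B}) (proj₁ (proj₂ B-basis)))

  lift-B⊆ : lift B ⊆ (W ∪ ⁅ σ x ⁆)
  lift-B⊆ = ⊆-trans (lift-mono ⊆-∖∪⁅⁆) lift-∪⁅⁆

  σx∉span : ¬ Span M W (col M (σ x))
  σx∉span spanned = span⇒¬Indep-∪⁅⁆ M spanned (trans (lift-σ (B ∖ x) x) (∖-self B x))
    (Indep-⊆ M (∪-lub (lift-mono (∖-⊆ {X = B})) (⁅⁆-⊆ {X = lift B} (trans (lift-σ B x) B∋x)))
               (Indep-lift (proj₁ (proj₂ B-basis))))

  off-pair-span : ∀ j → j ≢ x → j ≢ y → Span M W (col M (σ j))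
  off-pair-span j j≢x j≢y with B j in Bj
  ... | true  = span-col M (trans (lift-σ (B ∖ x) j) (∖-intro {X = B} Bj j≢x))
  ... | false with Span? M W (col M (σ j))
  ...   | yes spanned  = spanned
  ...   | no  σj∉span = ⊥-elim (≡true⇒≢false (meets B′ B′-basis) B′∌x,y)
    where
    B′ : FSet (cols N)
    B′ = (B ∖ x) ∪ ⁅ j ⁆

    lift-B-span : ∀ e → lift B e ≡ true → Span M (W ∪ ⁅ σ j ⁆) (col M e)
    lift-B-span e r with e ≟ σ x
    ... | yes refl = span-exchange M (span-mono M lift-B⊆ (basis-lift-span B-basis j)) σj∉span
    ... | no  e≢σx = span-col M (X⊆X∪Y {X = W} {Y = ⁅ σ j ⁆} e (∪⁅⁆-≢ {X = W} (lift-B⊆ e r) e≢σx))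

    B′-basis : Basis N B′
    B′-basis = spanning⇒Basis
      (Indep-lift⁻ (Indep-⊆ M lift-∪⁅⁆ (Indep-∪⁅⁆ M W-indep σj∉span)))
      (λ f → span-mono M ∪⁅⁆-lift (span-trans M lift-B-span (basis-lift-span B-basis f)))

    B′∌x,y : B′ x ∨ B′ y ≡ false
    B′∌x,y = ∨-≡false (∨-≡false (∖-self B x) (⁅⁆-other (λ x≡j → j≢x (sym x≡j))))
                      (∨-≡false (¬-not (λ r → ≡true⇒≢false (∖-⊆ {X = B} y r) B∌y))
                                (⁅⁆-other (λ y≡j → j≢y (sym y≡j))))

  no-odd-cycle : ∀ T → Disjoint T D → Cycle M T → T (σ x) ≡ true → T (σ y) ≡ false → ⊥
  no-odd-cycle T T∩D cyc Tσx Tσy = σx∉span (span-trans M spanned (cycle-span M cyc Tσx))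
    where
    spanned : ∀ e → (T ∖ σ x) e ≡ true → Span M W (col M e)
    spanned e r with C e in Ce
    ... | true  = span-mono M (Y⊆X∪Y {X = image σ (B ∖ x)}) (basis-span M J₀-basis Ce)
    ... | false with σ-onto (∨-≡false Ce (T∩D e (∖-⊆ {X = T} e r)))
    ...   | j , refl = off-pair-span j (λ { refl → ∖-≢ {X = T} r refl })
                                      (λ { refl → ≡true⇒≢false (∖-⊆ {X = T} e r) Tσy })

cocircuit⇒CyclesMeetEvenly : ∀ {M N C D x y} (iso : IsoMinor M C D N) → Cocircuit2 N x y →
                             CyclesMeetEvenly M D (Minor.σ iso x) (Minor.σ iso y)
cocircuit⇒CyclesMeetEvenly {x = x} {y} iso (meets , (B₁ , B₁-basis , B₁∌x) , (B₂ , B₂-basis , B₂∌y))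
                           T T∩D cyc
  with T (σ x) in Tσx | T (σ y) in Tσy
  where open Minor iso
... | true  | true  = refl
... | false | false = refl
... | true  | false =
  ⊥-elim (CocircuitParity.no-odd-cycle iso meets B₂-basis B₂∌y T T∩D cyc Tσx Tσy)
... | false | true  =
  ⊥-elim (CocircuitParity.no-odd-cycle iso meets′ B₁-basis B₁∌x T T∩D cyc Tσy Tσx)
  where
  meets′ : ∀ B → Basis _ B → B y ∨ B x ≡ true
  meets′ B B-basis = trans (∨-comm (B y) (B x)) (meets B B-basis)

mainTheorem1 : (F M : BinMatrix) →
    Σ BinMatrix (λ N → InTilde F N × HasMinor M N) →
    Σ (Fin (cols M)) (λ x → Σ (Fin (cols M)) (λ y → x ≢ y × HasMinor (split M x y) F))
mainTheorem1 F M (N , (x , y , x≢y , N∈F̃) , (C , D , iso)) = σ x , σ y , σx≢σy , minor N∈F̃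
  where
  open Minor iso

  σx≢σy : σ x ≢ σ y
  σx≢σy σx≡σy = x≢y (σ-inj σx≡σy)

  split-minor : ∀ {Cx Dx} → IsoMinor N Cx Dx F → CyclesMeetEvenly M (D ∪ image σ Dx) (σ x) (σ y) →
                HasMinor (split M (σ x) (σ y)) F
  split-minor isoF even = _ , _ , split-IsoMinor M σx≢σy even (IsoMinor-∘ iso isoF)

  deleted-pair-even : CyclesMeetEvenly M (D ∪ image σ (pair x y)) (σ x) (σ y)
  deleted-pair-even T T∩D′ _ =
    trans (avoids (∨-≡trueˡ _ (⁅⁆-self x))) (sym (avoids (∨-≡trueʳ _ (⁅⁆-self y))))
    where
    avoids : ∀ {i} → pair x y i ≡ true → T (σ i) ≡ false
    avoids {i} pair∋i = ¬-not λ Tσi → ≡true⇒≢false σi∈D′ (T∩D′ (σ i) Tσi)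
      where
      σi∈D′ : (D ∪ image σ (pair x y)) (σ i) ≡ true
      σi∈D′ = Y⊆X∪Y {X = D} {Y = image σ (pair x y)} (σ i)
                (image-intro σ {X = pair x y} {i} pair∋i refl)

  cocircuit-even : Cocircuit2 N x y → ∀ {Dx} → CyclesMeetEvenly M (D ∪ image σ Dx) (σ x) (σ y)
  cocircuit-even cc = CyclesMeetEvenly-mono X⊆X∪Y (cocircuit⇒CyclesMeetEvenly iso cc)

  minor : IsoMinor N ∅ (pair x y) F ⊎ (Cocircuit2 N x y × IsoMinor N ⁅ x ⁆ ∅ F)
          ⊎ (Cocircuit2 N x y × IsoMinor N (pair x y) ∅ F) →
          HasMinor (split M (σ x) (σ y)) F
  minor (inj₁ isoF)               = split-minor isoF deleted-pair-even
  minor (inj₂ (inj₁ (cc , isoF))) = split-minor isoF (cocircuit-even cc)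
  minor (inj₂ (inj₂ (cc , isoF))) = split-minor isoF (cocircuit-even cc)
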